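{- Consider the synchronization pattern with $n\in\mathbb{N}$ clients, with net $L=\textit{compose}(\{C_1,\dots,C_n,S\})$ and initial marking $m_0=\{i\}\cup\{i_j\mid 1\le j\le n\}$. Then for every marking $m$ reachable from $m_0$: if $m(q)=1$ then $\sum_{j=1}^n m(q_j)\le 1$; and if $\sum_{j=1}^n m(q_j)=1$ then $m(q)=1$.
   Context: Petri nets: ${}^\bullet x$ and $x^\bullet$ denote pre- and postset; markings are functions from places to $\mathbb{N}$ (sets identified with markings having one token per element); a transition is enabled iff each place of its preset holds a token, and firing removes one token from each preset place and adds one to each postset place. Composing OPNs takes the union of all places, transitions and arcs, shared places being identified. Synchronization pattern with $n$ clients: a server OPN $S$ with internal places $i,p,q,r$, input places $a_1,a_3$, output place $a_2$, and transitions $u,v,w,t$ with ${}^\bullet u=\{i,a_1\}$, $u^\bullet=\{p\}$; ${}^\bullet v=\{p\}$, $v^\bullet=\{q,a_2\}$; ${}^\bullet w=\{q,a_3\}$, $w^\bullet=\{r\}$; ${}^\bullet t=\{r\}$, $t^\bullet=\{i\}$. For $1\le j\le n$, a client OPN $C_j$ with internal places $i_j,p_j,q_j,r_j$, input place $a_2$, output places $a_1,a_3$, and transitions $u_j,v_j,w_j$ with ${}^\bullet u_j=\{i_j\}$, $u_j^\bullet=\{p_j,a_1\}$; ${}^\bullet v_j=\{p_j,a_2\}$, $v_j^\bullet=\{q_j\}$; ${}^\bullet w_j=\{q_j\}$, $w_j^\bullet=\{r_j,a_3\}$. All clients and the server share the places $a_1,a_2,a_3$ and are otherwise disjoint. 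-}

module Defs where

open import Data.Nat using (ℕ; zero; suc; _+_; _∸_; _≤_)
open import Data.Fin using (Fin; _≟_)
open import Data.Vec using (sum; tabulate)
open import Relation.Nullary.Decidable using (Dec; yes; no)
open import Relation.Binary.Construct.Closure.ReflexiveTransitive using (Star)

-- Places of L = compose({C_1,...,C_n,S}): the union of all places,
-- with the shared places a1,a2,a3 identified.  Client j is indexed by Fin n
-- (Fin n's element j corresponds to client j+1).
data Place (n : ℕ) : Set where
  i p q r a1 a2 a3 : Place n
  ic pc qc rc : Fin n → Place n

data Transition (n : ℕ) : Set where
  u v w t : Transition n
  uc vc wc : Fin n → Transition n

δ : ∀ {n} → Fin n → Fin n → ℕ
δ j k with j ≟ k
... | yes _ = 1
... | no _ = 0

pre : ∀ {n} → Transition n → Place n → ℕ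
pre u i = 1
pre u a1 = 1
pre v p = 1
pre w q = 1
pre w a3 = 1
pre t r = 1
pre (uc j) (ic k) = δ j k
pre (vc j) (pc k) = δ j k
pre (vc j) a2 = 1
pre (wc j) (qc k) = δ j k
pre _ _ = 0

post : ∀ {n} → Transition n → Place n → ℕ
post u p = 1
post v q = 1
post v a2 = 1
post w r = 1
post t i = 1
post (uc j) (pc k) = δ j k
post (uc j) a1 = 1
post (vc j) (qc k) = δ j k
post (wc j) (rc k) = δ j k
post (wc j) a3 = 1
post _ _ = 0

Marking : ℕ → Set
Marking n = Place n → ℕ

Enabled : ∀ {n} → Marking n → Transition n → Set
Enabled m tr = ∀ x → pre tr x ≤ m x

fire : ∀ {n} → Marking n → Transition n → Marking n
fire m tr x = (m x ∸ pre tr x) + post tr x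

data Step {n : ℕ} : Marking n → Marking n → Set where
  step : (m : Marking n) (tr : Transition n) → Enabled m tr → Step m (fire m tr)

Reachable : ∀ {n} → Marking n → Marking n → Set
Reachable = Star Step

m0 : ∀ {n} → Marking n
m0 i = 1
m0 (ic _) = 1
m0 _ = 0

sumQ : ∀ {n} → Marking n → ℕ
sumQ {n} m = sum (tabulate {n = n} (λ j → m (qc j)))

{-# OPTIONS --safe #-}
-- Two place invariants with non-negative weights are conserved by every
-- transition: the server's tokens i + p + q + r, and
-- i + p + r + a₂ + Σ q_j + a₃ (while the server waits in q its turn is held by
-- exactly one of a₂, some q_j, a₃).  Both are 1 at m₀; subtracting them gives
-- q = a₂ + Σ q_j + a₃ ≤ 1 in every reachable marking, whence both claims.
module Submission where

open import Defs
open import Data.Nat using (ℕ; zero; suc; _+_; _∸_; _≤_)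
open import Data.Nat.Properties
  using (+-∸-comm; m∸n+n≡m; ≤-trans; m≤m+n; m≤n+m; +-cancelʳ-≡; +-cancelˡ-≡;
         ≤-antisym; +-commutativeSemigroup)
open import Algebra.Properties.CommutativeSemigroup +-commutativeSemigroup
  using (interchange)
open import Data.Fin using (Fin; _≟_) renaming (zero to fzero; suc to fsuc)
open import Data.Vec using (sum; tabulate)
open import Data.Vec.Properties using (tabulate-cong)
open import Data.Product using (_×_; _,_)
open import Relation.Binary.PropositionalEquality
  using (_≡_; _≗_; refl; sym; trans; cong; cong₂; subst; module ≡-Reasoning)
open import Relation.Nullary.Decidable using (yes; no)
open import Relation.Binary.Construct.Closure.ReflexiveTransitive using (ε; _◅_)

sum-tabulate-+ : ∀ {n} (f g : Fin n → ℕ) →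
  sum (tabulate (λ k → f k + g k)) ≡ sum (tabulate f) + sum (tabulate g)
sum-tabulate-+ {zero}  f g = refl
sum-tabulate-+ {suc n} f g =
  trans (cong (f fzero + g fzero +_) (sum-tabulate-+ (λ k → f (fsuc k)) (λ k → g (fsuc k))))
        (interchange (f fzero) (g fzero) _ _)

sum-tabulate-0 : ∀ n → sum (tabulate {n = n} (λ _ → 0)) ≡ 0
sum-tabulate-0 zero    = refl
sum-tabulate-0 (suc n) = sum-tabulate-0 n

δ-suc : ∀ {n} (j k : Fin n) → δ (fsuc j) (fsuc k) ≡ δ j k
δ-suc j k with j ≟ k
... | yes _ = refl
... | no  _ = refl

sum-tabulate-δ : ∀ {n} (j : Fin n) → sum (tabulate (δ j)) ≡ 1
sum-tabulate-δ {suc n} fzero    = cong suc (sum-tabulate-0 n)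
sum-tabulate-δ {suc n} (fsuc j) =
  trans (cong sum (tabulate-cong (δ-suc j))) (sum-tabulate-δ j)

module _ {n : ℕ} where

  _⊕_ : Marking n → Marking n → Marking n
  (m ⊕ m′) x = m x + m′ x

  record IsLinear (L : Marking n → ℕ) : Set where
    field
      ≗-cong : ∀ {m m′} → m ≗ m′ → L m ≡ L m′
      +-homo : ∀ m m′ → L (m ⊕ m′) ≡ L m + L m′

  eval-isLinear : ∀ x → IsLinear (λ m → m x)
  eval-isLinear x = record { ≗-cong = λ eq → eq x ; +-homo = λ _ _ → refl }

  +-isLinear : ∀ {L K} → IsLinear L → IsLinear K → IsLinear (λ m → L m + K m)
  +-isLinear {L} {K} isL isK = record
    { ≗-cong = λ eq → cong₂ _+_ (L.≗-cong eq) (K.≗-cong eq)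
    ; +-homo = λ m m′ → trans (cong₂ _+_ (L.+-homo m m′) (K.+-homo m m′))
                              (interchange (L m) (L m′) (K m) (K m′))
    }
    where module L = IsLinear isL
          module K = IsLinear isK

  sumQ-isLinear : IsLinear sumQ
  sumQ-isLinear = record
    { ≗-cong = λ eq → cong sum (tabulate-cong (λ k → eq (qc k)))
    ; +-homo = λ m m′ → sum-tabulate-+ (λ k → m (qc k)) (λ k → m′ (qc k))
    }

  fire-+-pre : ∀ {m} tr → Enabled m tr → fire m tr ⊕ pre tr ≗ m ⊕ post tr
  fire-+-pre {m} tr en x = begin
    (m x ∸ pre tr x) + post tr x + pre tr x ≡⟨ cong (_+ pre tr x) (+-∸-comm (post tr x) (en x)) ⟨
    (m x + post tr x ∸ pre tr x) + pre tr x ≡⟨ m∸n+n≡m (≤-trans (en x) (m≤m+n (m x) (post tr x))) ⟩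
    m x + post tr x                         ∎
    where open ≡-Reasoning

  IsPlaceInvariant : (Marking n → ℕ) → Set
  IsPlaceInvariant L = IsLinear L × (∀ tr → L (pre tr) ≡ L (post tr))

  fire-invariant : ∀ {L m} tr → IsPlaceInvariant L → Enabled m tr → L (fire m tr) ≡ L m
  fire-invariant {L} {m} tr (isL , balanced) en = +-cancelʳ-≡ (L (pre tr)) _ _ (begin
    L (fire m tr) + L (pre tr) ≡⟨ L.+-homo (fire m tr) (pre tr) ⟨
    L (fire m tr ⊕ pre tr)     ≡⟨ L.≗-cong (fire-+-pre tr en) ⟩
    L (m ⊕ post tr)            ≡⟨ L.+-homo m (post tr) ⟩
    L m + L (post tr)          ≡⟨ cong (L m +_) (balanced tr) ⟨
    L m + L (pre tr)           ∎)
    where open ≡-Reasoning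
          module L = IsLinear isL

  reachable-invariant : ∀ {L m m′} → IsPlaceInvariant L → Reachable m m′ → L m′ ≡ L m
  reachable-invariant inv ε                      = refl
  reachable-invariant inv (step m tr en ◅ steps) =
    trans (reachable-invariant inv steps) (fire-invariant tr inv en)

module _ {n : ℕ} where

  idle serverTokens handshake turnTokens : Marking n → ℕ
  idle m         = m i + m p + m r
  serverTokens m = idle m + m q
  handshake m    = m a2 + sumQ m + m a3
  turnTokens m   = idle m + handshake m

  idle-isLinear : IsLinear idle
  idle-isLinear = +-isLinear (+-isLinear (eval-isLinear i) (eval-isLinear p)) (eval-isLinear r)

  serverTokens-isPlaceInvariant : IsPlaceInvariant serverTokens
  serverTokens-isPlaceInvariant = +-isLinear idle-isLinear (eval-isLinear q) , balanced
    where
    balanced : ∀ tr → serverTokens (pre tr) ≡ serverTokens (post tr)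
    balanced u      = refl
    balanced v      = refl
    balanced w      = refl
    balanced t      = refl
    balanced (uc _) = refl
    balanced (vc _) = refl
    balanced (wc _) = refl

  turnTokens-isPlaceInvariant : IsPlaceInvariant turnTokens
  turnTokens-isPlaceInvariant =
    +-isLinear idle-isLinear
      (+-isLinear (+-isLinear (eval-isLinear a2) sumQ-isLinear) (eval-isLinear a3))
    , balanced
    where
    balanced : ∀ tr → turnTokens (pre tr) ≡ turnTokens (post tr)
    balanced u      = refl
    balanced v      = refl
    balanced w      rewrite sum-tabulate-0 n = refl
    balanced t      = refl
    balanced (uc _) = refl
    balanced (vc j) rewrite sum-tabulate-0 n | sum-tabulate-δ j = refl
    balanced (wc j) rewrite sum-tabulate-0 n | sum-tabulate-δ j = refl

  turnTokens-m0 : turnTokens (m0 {n}) ≡ 1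
  turnTokens-m0 rewrite sum-tabulate-0 n = refl

  module _ {m : Marking n} (reachable : Reachable m0 m) where

    serverTokens≡1 : serverTokens m ≡ 1
    serverTokens≡1 = reachable-invariant serverTokens-isPlaceInvariant reachable

    turnTokens≡1 : turnTokens m ≡ 1
    turnTokens≡1 = trans (reachable-invariant turnTokens-isPlaceInvariant reachable) turnTokens-m0

    q≡handshake : m q ≡ handshake m
    q≡handshake = +-cancelˡ-≡ (idle m) _ _ (trans serverTokens≡1 (sym turnTokens≡1))

    q≤1 : m q ≤ 1
    q≤1 = subst (m q ≤_) serverTokens≡1 (m≤n+m (m q) (idle m))

    sumQ≤q : sumQ m ≤ m q
    sumQ≤q = subst (sumQ m ≤_) (sym q≡handshake)
      (≤-trans (m≤n+m (sumQ m) (m a2)) (m≤m+n (m a2 + sumQ m) (m a3)))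

corollary2 : (n : ℕ) (m : Marking n) → Reachable (m0 {n}) m →
    ((m q ≡ 1 → sumQ m ≤ 1) × (sumQ m ≡ 1 → m q ≡ 1))
corollary2 n m reachable =
    (λ q≡1 → subst (sumQ m ≤_) q≡1 (sumQ≤q reachable))
  , (λ sumQ≡1 → ≤-antisym (q≤1 reachable) (subst (_≤ m q) sumQ≡1 (sumQ≤q reachable)))
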